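{- Let $q\ge 4$ be a power of $2$. Then there exists a linear AOA$(2,3,q+1,q)$.
   Context: An orthogonal array OA$(t,k,v)$ is a $v^t\times k$ array with entries from a set $X$ of size $v$ such that the restriction to any $t$ columns contains every $t$-tuple of $X^t$ exactly once. An AOA$(s,t,k,v)$ is a $v^t\times (k+1)$ array $A$ such that: (1) the first $k$ columns form an OA$(t,k,v)$ on a set $X$ with $|X|=v$; (2) the last column has symbols from a set $Y$ with $|Y|=v^{t-s}$; (3) any $s$ of the first $k$ columns together with the last column contain every $(s+1)$-tuple of $X^s\times Y$ exactly once. A linear AOA$(s,t,k,q)$ is an AOA$(s,t,k,q)$ with $X=\mathbb{F}_q$, $Y=\mathbb{F}_q^{t-s}$, whose set of rows, each regarded as a vector of $\mathbb{F}_q^{k+t-s}$ (first $k$ entries followed by the $t-s$ coordinates of the last entry), is a $t$-dimensional $\mathbb{F}_q$-subspace. -}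

module Defs where

open import Level using (0ℓ)
open import Data.Nat as ℕ using (ℕ; zero; suc; _^_; _∸_)
open import Data.Fin using (Fin; zero; suc)
open import Data.Vec using (Vec; tabulate; _++_; replicate; zipWith; map)
open import Data.Product using (Σ; ∃; ∃!; _×_; _,_)
open import Function using (_∘_)
open import Function.Bundles using (_↔_)
open import Function.Definitions using (Injective)
open import Relation.Nullary using (¬_)
open import Relation.Binary.PropositionalEquality using (_≡_)
open import Algebra.Core using (Op₁; Op₂)
open import Algebra.Structures using (IsCommutativeRing)

record FiniteField (q : ℕ) : Set₁ where
  field
    Carrier : Set
    _⊕_ _⊗_ : Op₂ Carrier
    ⊖_ : Op₁ Carrier
    𝟘 𝟙 : Carrier
    isCommutativeRing : IsCommutativeRing _≡_ _⊕_ _⊗_ ⊖_ 𝟘 𝟙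
    𝟘≢𝟙 : ¬ (𝟘 ≡ 𝟙)
    inverse : ∀ x → ¬ (x ≡ 𝟘) → ∃ λ y → x ⊗ y ≡ 𝟙
    size : Fin q ↔ Carrier

module LinAlg {q : ℕ} (F : FiniteField q) where
  open FiniteField F

  _+ᵛ_ : ∀ {n} → Vec Carrier n → Vec Carrier n → Vec Carrier n
  _+ᵛ_ = zipWith _⊕_

  _·ᵛ_ : ∀ {n} → Carrier → Vec Carrier n → Vec Carrier n
  c ·ᵛ v = map (c ⊗_) v

  0ᵛ : ∀ {n} → Vec Carrier n
  0ᵛ = replicate _ 𝟘

  lincomb : ∀ {t n} → (Fin t → Carrier) → (Fin t → Vec Carrier n) → Vec Carrier n
  lincomb {zero}  a b = 0ᵛ
  lincomb {suc t} a b = (a zero ·ᵛ b zero) +ᵛ lincomb (a ∘ suc) (b ∘ suc)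

  LinIndep : ∀ {t n} → (Fin t → Vec Carrier n) → Set
  LinIndep b = ∀ a → lincomb a b ≡ 0ᵛ → ∀ i → a i ≡ 𝟘

  IsSubspace : ∀ {n} → (Vec Carrier n → Set) → Set
  IsSubspace S = S 0ᵛ
               × (∀ u v → S u → S v → S (u +ᵛ v))
               × (∀ c v → S v → S (c ·ᵛ v))

  IsSubspaceOfDim : ∀ {n} → ℕ → (Vec Carrier n → Set) → Set
  IsSubspaceOfDim {n} t S =
    IsSubspace S ×
    Σ (Fin t → Vec Carrier n) λ b →
      (∀ i → S (b i)) × LinIndep b × (∀ v → S v → ∃ λ a → lincomb a b ≡ v)

-- An array with v^t rows and k columns over X is
-- A : Fin (v ^ t) → Fin k → X  (A r c = entry in row r, column c).
-- "The restriction to any t columns contains every t-tuple exactly once":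
-- for every choice of t distinct columns c₁,…,c_t and every tuple u ∈ X^t
-- there is exactly one row r with (A r c₁, …, A r c_t) = u.

IsOA : {X : Set} (t k v : ℕ) → (Fin (v ^ t) → Fin k → X) → Set
IsOA {X} t k v A =
  (c : Fin t → Fin k) → Injective _≡_ _≡_ c →
  (u : Vec X t) → ∃! _≡_ (λ r → tabulate (λ i → A r (c i)) ≡ u)

-- Augmented orthogonal array AOA(s,t,k,v) on a v-set X, last column over
-- a set Y with |Y| = v^(t-s).
record AOA (s t k v : ℕ) : Set₁ where
  field
    X Y   : Set
    sizeX : Fin v ↔ X
    sizeY : Fin (v ^ (t ∸ s)) ↔ Y
    A     : Fin (v ^ t) → Fin k → X
    L     : Fin (v ^ t) → Y
    isOA  : IsOA t k v A
    aug   : (c : Fin s → Fin k) → Injective _≡_ _≡_ c →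
            (u : Vec X s) (y : Y) →
            ∃! _≡_ (λ r → tabulate (λ i → A r (c i)) ≡ u × L r ≡ y)

record LinearAOA {q : ℕ} (F : FiniteField q) (s t k : ℕ) : Set where
  open FiniteField F using (Carrier)
  open LinAlg F
  field
    A     : Fin (q ^ t) → Fin k → Carrier
    L     : Fin (q ^ t) → Vec Carrier (t ∸ s)
    isOA  : IsOA t k q A
    aug   : (c : Fin s → Fin k) → Injective _≡_ _≡_ c →
            (u : Vec Carrier s) (y : Vec Carrier (t ∸ s)) →
            ∃! _≡_ (λ r → tabulate (λ i → A r (c i)) ≡ u × L r ≡ y)
  row : Fin (q ^ t) → Vec Carrier (k ℕ.+ (t ∸ s))
  row r = tabulate (A r) ++ L r
  field
    linear : IsSubspaceOfDim t (λ w → ∃ λ r → row r ≡ w)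

-- Index the q³ rows by the points X of F³ and give column j the entry Pⱼ · X, where the Pⱼ are
-- the q + 1 points of the conic y² = xz, namely (1, t, t²) for t ∈ F and (0, 0, 1); the last
-- column is N · X for the nucleus N = (0, 1, 0).  By Cramer's rule three columns (or two columns
-- and the last one) take every triple of values exactly once iff their points are linearly
-- independent.  No three points of the conic are collinear, and in characteristic 2 every
-- tangent of the conic passes through N, so no two of them are collinear with N either.  The
-- field has characteristic 2 because q is even: otherwise x ↦ -x would be an involution of F
-- with the single fixed point 0, forcing q to be odd.  Finally the rows are the image of the
-- injective linear map X ↦ (Pⱼ · X)ⱼ, a 3-dimensional subspace.
module Submission where

open import Defs
open import Data.Nat using (ℕ; _+_; _^_; _≤_)
open import Data.Product using (∃)
open import Relation.Binary.PropositionalEquality using (_≡_)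

open import Algebra.Bundles using (CommutativeRing; RawRing; RawSemiring)
import Algebra.Properties.Ring as RingProperties
import Algebra.Solver.Ring as RingSolver
open import Algebra.Solver.Ring.AlmostCommutativeRing
  using (fromCommutativeRing; _-Raw-AlmostCommutative⟶_; Induced-equivalence)
open import Data.Bool.Base using (Bool; true; false; if_then_else_; _xor_; _∧_)
open import Data.Empty using (⊥-elim)
open import Data.Fin.Base using (Fin; zero; suc; punchIn; _<_)
open import Data.Fin.Patterns using (0F; 1F; 2F)
open import Data.Fin.Permutation using (Permutation; permutation)
import Data.Fin.Properties as Fin
open import Data.Maybe.Base using (Maybe; just; nothing)
open import Data.Nat using (zero; suc; _*_; s≤s)
open import Data.Nat.Divisibility using (_∣_; ∣-refl; ∣m+n∣m⇒∣n; ∣1⇒≡1; m∣m*n)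
import Data.Nat.Properties as ℕ
open import Algebra.Properties.CommutativeMonoid.Sum ℕ.+-0-commutativeMonoid
  using (sum; sum-remove; sum-permute; ∑-distrib-+; sum-cong-≗)
open import Data.Product using (_×_; _,_; proj₁; proj₂; ∃!; uncurry)
open import Data.Product.Function.NonDependent.Propositional using (_×-↔_)
open import Data.Sum.Base using (_⊎_; inj₁; inj₂)
open import Data.Sum.Function.Propositional using (_⊎-↔_)
open import Data.Unit.Base using (⊤; tt)
open import Data.Vec.Base using (Vec; []; _∷_; tabulate; _++_; zipWith; lookup)
open import Data.Vec.Properties
  using (tabulate-cong; tabulate-∘; map-cong; map-const; map-∘; map-id; zipWith-++; map-++;
         ++-injective; lookup∘tabulate)
open import Function.Base using (_∘_; id)
open import Function.Bundles using (Inverse; Injection; _↔_; mk↔ₛ′)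
open import Function.Definitions using (Injective)
open import Function.Properties.Inverse using (↔-trans; ↔-sym; ↔⇒↣)
open import Relation.Binary.Definitions using (DecidableEquality; tri<; tri≈; tri>)
open import Relation.Binary.PropositionalEquality
  using (refl; sym; trans; cong; cong₂; subst; _≢_; module ≡-Reasoning)
open import Relation.Nullary using (¬_; does; yes; no; contradiction)
open import Relation.Nullary.Decidable using (dec-true; dec-false; map′)

¬2∣1+k+k : ∀ k → ¬ 2 ∣ suc (k + k)
¬2∣1+k+k zero    2∣1 = contradiction (∣1⇒≡1 2∣1) λ ()
¬2∣1+k+k (suc k) 2∣n =
  ¬2∣1+k+k k (∣m+n∣m⇒∣n (subst (2 ∣_) (cong (λ m → 2 + m) (ℕ.+-suc k k)) 2∣n) ∣-refl)

sum-ones : ∀ n → sum {n} (λ _ → 1) ≡ n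
sum-ones zero    = refl
sum-ones (suc n) = cong suc (sum-ones n)

module InvolutionAscents {n : ℕ} (g : Fin n → Fin n) (g-involutive : ∀ i → g (g i) ≡ i) where

  ascent : Fin n → ℕ
  ascent i = if does (i Fin.<? g i) then 1 else 0

  ascent-yes : ∀ {i} → i < g i → ascent i ≡ 1
  ascent-yes {i} i<gi = cong (λ b → if b then 1 else 0) (dec-true (i Fin.<? g i) i<gi)

  ascent-no : ∀ {i} → ¬ i < g i → ascent i ≡ 0
  ascent-no {i} i≮gi = cong (λ b → if b then 1 else 0) (dec-false (i Fin.<? g i) i≮gi)

  ascents-in-orbit : ∀ i → g i ≢ i → ascent i + ascent (g i) ≡ 1
  ascents-in-orbit i gi≢i with Fin.<-cmp i (g i)
  ... | tri< i<gi _ _ =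
    cong₂ _+_ (ascent-yes i<gi) (ascent-no (Fin.<-asym i<gi ∘ subst (g i <_) (g-involutive i)))
  ... | tri≈ _ i≡gi _ = ⊥-elim (gi≢i (sym i≡gi))
  ... | tri> _ _ gi<i =
    cong₂ _+_ (ascent-no (Fin.<-asym gi<i)) (ascent-yes (subst (g i <_) (sym (g-involutive i)) gi<i))

-- Every orbit {i, g i} other than {z} contains exactly one ascent i < g i, and g permutes the
-- ascents with the descents, so n = 1 + 2 · (number of ascents).
involution-with-unique-fixed-point⇒¬2∣ :
  ∀ {n} (g : Fin n → Fin n) → (∀ i → g (g i) ≡ i) →
  (z : Fin n) → g z ≡ z → (∀ i → g i ≡ i → i ≡ z) → ¬ 2 ∣ n
involution-with-unique-fixed-point⇒¬2∣ {suc n} g g-involutive z gz≡z fixed⇒z 2∣n =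
  ¬2∣1+k+k (sum ascent) (subst (2 ∣_) count 2∣n)
  where
  open InvolutionAscents g g-involutive
  open ≡-Reasoning

  orbitAscents : Fin (suc n) → ℕ
  orbitAscents i = ascent i + ascent (g i)

  orbitAscents-z : orbitAscents z ≡ 0
  orbitAscents-z = cong₂ _+_ (ascent-no (Fin.<-irrefl (sym gz≡z)))
                             (ascent-no (Fin.<-irrefl (trans gz≡z (sym (g-involutive z)))))

  count : suc n ≡ suc (sum ascent + sum ascent)
  count = cong suc (begin
    n                                                ≡⟨ sum-ones n ⟨
    sum {n} (λ _ → 1)                                ≡⟨ sum-cong-≗ orbit-of-punchIn ⟨
    sum (orbitAscents ∘ punchIn z)                   ≡⟨ cong (_+ sum (orbitAscents ∘ punchIn z))
                                                             orbitAscents-z ⟨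
    orbitAscents z + sum (orbitAscents ∘ punchIn z)  ≡⟨ sum-remove orbitAscents ⟨
    sum orbitAscents                                 ≡⟨ ∑-distrib-+ ascent (ascent ∘ g) ⟩
    sum ascent + sum (ascent ∘ g)                    ≡⟨ cong (sum ascent +_) (sum-permute ascent π) ⟨
    sum ascent + sum ascent                          ∎)
    where
    orbit-of-punchIn : ∀ j → orbitAscents (punchIn z j) ≡ 1
    orbit-of-punchIn j = ascents-in-orbit (punchIn z j) (Fin.punchInᵢ≢i z j ∘ fixed⇒z (punchIn z j))
    π : Permutation (suc n) (suc n)
    π = permutation g g g-involutive g-involutive

∃!-map : ∀ {A : Set} {P Q : A → Set} → (∀ {x} → P x → Q x) → (∀ {x} → Q x → P x) →
         ∃! _≡_ P → ∃! _≡_ Q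
∃!-map P⇒Q Q⇒P (x , Px , unique) = x , P⇒Q Px , unique ∘ Q⇒P

∃!-preimage : ∀ {I A B : Set} (e : I ↔ A) (f : A → B) → Injective _≡_ _≡_ f →
              (∀ b → ∃ λ a → f a ≡ b) → ∀ b → ∃! _≡_ (λ i → f (Inverse.to e i) ≡ b)
∃!-preimage e f f-injective f-surjective b with f-surjective b
... | a , fa≡b =
  from a , trans (cong f (strictlyInverseˡ a)) fa≡b ,
  λ {i} fi≡b → trans (cong from (f-injective (trans fa≡b (sym fi≡b)))) (strictlyInverseʳ i)
  where open Inverse e using (from; strictlyInverseˡ; strictlyInverseʳ)

^3↔×³ : ∀ {v} {X : Set} → Fin v ↔ X → Fin (v ^ 3) ↔ (X × X × X)
^3↔×³ {v} {X} e = ↔-trans Fin.*↔× (e ×-↔ ↔-trans Fin.*↔× (e ×-↔ Fin[v*1]↔X))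
  where
  Fin[v*1]↔X : Fin (v * 1) ↔ X
  Fin[v*1]↔X = ↔-trans Fin.*↔× (↔-trans (e ×-↔ Fin.1↔⊤) X×⊤↔X)
    where
    X×⊤↔X : (X × ⊤) ↔ X
    X×⊤↔X = mk↔ₛ′ proj₁ (_, tt) (λ _ → refl) (λ _ → refl)

zipWith-tabulate : ∀ {n} {A B C : Set} (_∙_ : A → B → C) (f : Fin n → A) (g : Fin n → B) →
                   zipWith _∙_ (tabulate f) (tabulate g) ≡ tabulate (λ i → f i ∙ g i)
zipWith-tabulate {zero}  _∙_ f g = refl
zipWith-tabulate {suc n} _∙_ f g =
  cong (f zero ∙ g zero ∷_) (zipWith-tabulate _∙_ (f ∘ suc) (g ∘ suc))

≡³ : ∀ {a} {K : Set a} {x y z x′ y′ z′ : K} →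
     x ≡ x′ → y ≡ y′ → z ≡ z′ → (x , y , z) ≡ (x′ , y′ , z′)
≡³ p q r = cong₂ _,_ p (cong₂ _,_ q r)

-- Cross product and determinant carry no signs: they are the usual ones in characteristic 2.
module Coordinates {c ℓ} (R : RawSemiring c ℓ) where
  open RawSemiring R renaming (Carrier to K; _+_ to _⊕_; _*_ to _⊗_; 0# to 𝟘; 1# to 𝟙)

  infixl 7 _+³_
  infixr 8 _·³_
  infix  9 _∙_ _⨯_

  K³ : Set c
  K³ = K × K × K

  0³ : K³
  0³ = 𝟘 , 𝟘 , 𝟘

  _+³_ : K³ → K³ → K³
  (x , y , z) +³ (x′ , y′ , z′) = x ⊕ x′ , y ⊕ y′ , z ⊕ z′

  _·³_ : K → K³ → K³
  a ·³ (x , y , z) = a ⊗ x , a ⊗ y , a ⊗ z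

  _∙_ : K³ → K³ → K
  (a , b , c) ∙ (x , y , z) = a ⊗ x ⊕ b ⊗ y ⊕ c ⊗ z

  _⨯_ : K³ → K³ → K³
  (a , b , c) ⨯ (x , y , z) = b ⊗ z ⊕ c ⊗ y , c ⊗ x ⊕ a ⊗ z , a ⊗ y ⊕ b ⊗ x

  det : K³ → K³ → K³ → K
  det m₀ m₁ m₂ = m₀ ∙ (m₁ ⨯ m₂)

  evaluate : ∀ {n} → (Fin n → K³) → K³ → Vec K n
  evaluate M X = tabulate (λ j → M j ∙ X)

  linearForms : K³ → K³ → K³ → K³ → Vec K 3
  linearForms m₀ m₁ m₂ = evaluate (lookup (m₀ ∷ m₁ ∷ m₂ ∷ []))

  adjugate : K³ → K³ → K³ → Vec K 3 → K³
  adjugate m₀ m₁ m₂ (u ∷ v ∷ w ∷ []) =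
    u ·³ (m₁ ⨯ m₂) +³ v ·³ (m₂ ⨯ m₀) +³ w ·³ (m₀ ⨯ m₁)

  unit : Fin 3 → K³
  unit 0F = 𝟙 , 𝟘 , 𝟘
  unit 1F = 𝟘 , 𝟙 , 𝟘
  unit 2F = 𝟘 , 𝟘 , 𝟙

  coordinates : (Fin 3 → K) → K³
  coordinates a = a 0F , a 1F , a 2F

  coordinate : Fin 3 → K³ → K
  coordinate 0F (x , _ , _) = x
  coordinate 1F (_ , y , _) = y
  coordinate 2F (_ , _ , z) = z

  conic : K → K³
  conic t = 𝟙 , t , t ⊗ t

  infinity nucleus : K³
  infinity = 𝟘 , 𝟘 , 𝟙
  nucleus  = 𝟘 , 𝟙 , 𝟘

module FieldProperties {q : ℕ} (F : FiniteField q) where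
  open FiniteField F using (Carrier; isCommutativeRing; inverse; size)
  open Inverse size using (to; from; strictlyInverseˡ; strictlyInverseʳ)
  open LinAlg F using (_·ᵛ_; 0ᵛ)
  open ≡-Reasoning

  commutativeRing : CommutativeRing _ _
  commutativeRing = record { isCommutativeRing = isCommutativeRing }

  open CommutativeRing commutativeRing
    using (*-assoc; *-comm; *-identityˡ; zeroˡ; zeroʳ; distribʳ; -‿inverseʳ)
    renaming (_+_ to _⊕_; _*_ to _⊗_; -_ to ⊖_; 0# to 𝟘; 1# to 𝟙)
  open RingProperties (CommutativeRing.ring commutativeRing) using (-0#≈0#; -‿involutive)

  _≟_ : DecidableEquality Carrier
  x ≟ y = map′ (Injection.injective (↔⇒↣ (↔-sym size))) (cong from) (from x Fin.≟ from y)

  inverse-⊗-cancel : ∀ {x x′} y → x ⊗ x′ ≡ 𝟙 → x′ ⊗ (x ⊗ y) ≡ y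
  inverse-⊗-cancel {x} {x′} y xx′≡1 = begin
    x′ ⊗ (x ⊗ y)   ≡⟨ *-assoc x′ x y ⟨
    (x′ ⊗ x) ⊗ y   ≡⟨ cong (_⊗ y) (trans (*-comm x′ x) xx′≡1) ⟩
    𝟙 ⊗ y          ≡⟨ *-identityˡ y ⟩
    y              ∎

  ⊗-cancelˡ : ∀ {x y z} → x ≢ 𝟘 → x ⊗ y ≡ x ⊗ z → y ≡ z
  ⊗-cancelˡ {x} {y} {z} x≢0 xy≡xz with inverse x x≢0
  ... | x′ , xx′≡1 = begin
    y              ≡⟨ inverse-⊗-cancel y xx′≡1 ⟨
    x′ ⊗ (x ⊗ y)   ≡⟨ cong (x′ ⊗_) xy≡xz ⟩
    x′ ⊗ (x ⊗ z)   ≡⟨ inverse-⊗-cancel z xx′≡1 ⟩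
    z              ∎

  ⊗-≢𝟘 : ∀ {x y} → x ≢ 𝟘 → y ≢ 𝟘 → x ⊗ y ≢ 𝟘
  ⊗-≢𝟘 {x} x≢0 y≢0 xy≡0 = y≢0 (⊗-cancelˡ x≢0 (trans xy≡0 (sym (zeroʳ x))))

  inverse-·ᵛ-cancel : ∀ {n x x′} (v : Vec Carrier n) →
                      x ⊗ x′ ≡ 𝟙 → x′ ·ᵛ (x ·ᵛ v) ≡ v
  inverse-·ᵛ-cancel v xx′≡1 =
    trans (sym (map-∘ _ _ v)) (trans (map-cong (λ y → inverse-⊗-cancel y xx′≡1) v) (map-id v))

  𝟘·ᵛ : ∀ {n} (v : Vec Carrier n) → 𝟘 ·ᵛ v ≡ 0ᵛ
  𝟘·ᵛ v = trans (map-cong zeroˡ v) (map-const v 𝟘)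

  self-inverse⇒𝟘 : 𝟙 ⊕ 𝟙 ≢ 𝟘 → ∀ {x} → ⊖ x ≡ x → x ≡ 𝟘
  self-inverse⇒𝟘 2≢0 {x} ⊖x≡x = ⊗-cancelˡ 2≢0 (begin
    (𝟙 ⊕ 𝟙) ⊗ x     ≡⟨ distribʳ x 𝟙 𝟙 ⟩
    𝟙 ⊗ x ⊕ 𝟙 ⊗ x   ≡⟨ cong₂ _⊕_ (*-identityˡ x) (trans (*-identityˡ x) (sym ⊖x≡x)) ⟩
    x ⊕ ⊖ x         ≡⟨ -‿inverseʳ x ⟩
    𝟘               ≡⟨ zeroʳ (𝟙 ⊕ 𝟙) ⟨
    (𝟙 ⊕ 𝟙) ⊗ 𝟘     ∎)

  CharacteristicTwo : Set
  CharacteristicTwo = 𝟙 ⊕ 𝟙 ≡ 𝟘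

  characteristic-two : 2 ∣ q → CharacteristicTwo
  characteristic-two 2∣q with (𝟙 ⊕ 𝟙) ≟ 𝟘
  ... | yes 2≡0 = 2≡0
  ... | no  2≢0 =
    ⊥-elim (involution-with-unique-fixed-point⇒¬2∣ negation negation-involutive
              (from 𝟘) negation-𝟘 negation-fixed⇒𝟘 2∣q)
    where
    negation : Fin q → Fin q
    negation i = from (⊖ to i)

    negation-involutive : ∀ i → negation (negation i) ≡ i
    negation-involutive i =
      trans (cong from (trans (cong ⊖_ (strictlyInverseˡ (⊖ to i))) (-‿involutive (to i))))
            (strictlyInverseʳ i)

    negation-𝟘 : negation (from 𝟘) ≡ from 𝟘
    negation-𝟘 = cong from (trans (cong ⊖_ (strictlyInverseˡ 𝟘)) -0#≈0#)

    negation-fixed⇒𝟘 : ∀ i → negation i ≡ i → i ≡ from 𝟘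
    negation-fixed⇒𝟘 i fixed =
      trans (sym (strictlyInverseʳ i))
            (cong from (self-inverse⇒𝟘 2≢0
              (trans (sym (strictlyInverseˡ (⊖ to i))) (cong to fixed))))

module Characteristic2 {q : ℕ} (F : FiniteField q) (1+1≡0 : FieldProperties.CharacteristicTwo F) where
  open FiniteField F using (Carrier; 𝟘≢𝟙; inverse; size)
  open FieldProperties F
  open LinAlg F using (_+ᵛ_; _·ᵛ_; 0ᵛ; lincomb; LinIndep; IsSubspaceOfDim)
  open CommutativeRing commutativeRing
    using (+-identityˡ; +-identityʳ; *-identityˡ; zeroˡ)
    renaming (_+_ to _⊕_; _*_ to _⊗_; 0# to 𝟘; 1# to 𝟙)
  open RingProperties (CommutativeRing.ring commutativeRing) using (-0#≈0#; +-inverseʳ-unique)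
  open Coordinates (RawRing.rawSemiring (CommutativeRing.rawRing commutativeRing))
  open ≡-Reasoning

  -- The ring solver needs coefficients that compute; in characteristic 2 they can be taken in 𝔽₂.
  𝔽₂ : RawRing _ _
  𝔽₂ = record
    { Carrier = Bool ; _≈_ = _≡_ ; _+_ = _xor_ ; _*_ = _∧_ ; -_ = id ; 0# = false ; 1# = true }

  𝔽₂⟶F : 𝔽₂ -Raw-AlmostCommutative⟶ fromCommutativeRing commutativeRing
  𝔽₂⟶F = record
    { ⟦_⟧    = λ b → if b then 𝟙 else 𝟘
    ; +-homo = λ { false y     → sym (+-identityˡ _)
                 ; true  false → sym (+-identityʳ 𝟙)
                 ; true  true  → sym 1+1≡0 }
    ; *-homo = λ { false y → sym (zeroˡ _) ; true y → sym (*-identityˡ _) }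
    ; -‿homo = λ { false → sym -0#≈0# ; true → +-inverseʳ-unique 𝟙 𝟙 1+1≡0 }
    ; 0-homo = refl
    ; 1-homo = refl
    }

  _≟𝔽₂_ : ∀ a b → Maybe (Induced-equivalence 𝔽₂⟶F a b)
  false ≟𝔽₂ false = just refl
  true  ≟𝔽₂ true  = just refl
  _     ≟𝔽₂ _     = nothing

  open RingSolver 𝔽₂ (fromCommutativeRing commutativeRing) 𝔽₂⟶F _≟𝔽₂_
    using (solve; _:=_; Polynomial; con; _:+_; _:*_)

  polynomialSemiring : ℕ → RawSemiring _ _
  polynomialSemiring n = record
    { Carrier = Polynomial n ; _≈_ = _≡_ ; _+_ = _:+_ ; _*_ = _:*_ ; 0# = con false ; 1# = con true }

  module P {n} = Coordinates (polynomialSemiring n)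

  ⊕≡𝟘⇒≡ : ∀ {x y} → x ⊕ y ≡ 𝟘 → x ≡ y
  ⊕≡𝟘⇒≡ {x} {y} x+y≡0 = begin
    x              ≡⟨ solve 2 (λ x y → x := x :+ y :+ y) refl x y ⟩
    x ⊕ y ⊕ y      ≡⟨ cong (_⊕ y) x+y≡0 ⟩
    𝟘 ⊕ y          ≡⟨ +-identityˡ y ⟩
    y              ∎

  ∙-+³ : ∀ M X Y → M ∙ (X +³ Y) ≡ M ∙ X ⊕ M ∙ Y
  ∙-+³ (a , b , c) (x , y , z) (x′ , y′ , z′) =
    solve 9 (λ a b c x y z x′ y′ z′ → let M = a , b , c ; X = x , y , z ; Y = x′ , y′ , z′ in
      M P.∙ (X P.+³ Y) := M P.∙ X :+ M P.∙ Y) refl a b c x y z x′ y′ z′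

  ∙-·³ : ∀ M s X → M ∙ (s ·³ X) ≡ s ⊗ (M ∙ X)
  ∙-·³ (a , b , c) s (x , y , z) =
    solve 7 (λ a b c s x y z → let M = a , b , c ; X = x , y , z in
      M P.∙ (s P.·³ X) := s :* (M P.∙ X)) refl a b c s x y z

  𝟘·³ : ∀ X → 𝟘 ·³ X ≡ 0³
  𝟘·³ (x , y , z) = ≡³ (zeroˡ x) (zeroˡ y) (zeroˡ z)

  ·³-cancelˡ : ∀ {s X Y} → s ≢ 𝟘 → s ·³ X ≡ s ·³ Y → X ≡ Y
  ·³-cancelˡ s≢0 sX≡sY =
    ≡³ (⊗-cancelˡ s≢0 (cong (coordinate 0F) sX≡sY))
       (⊗-cancelˡ s≢0 (cong (coordinate 1F) sX≡sY))
       (⊗-cancelˡ s≢0 (cong (coordinate 2F) sX≡sY))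

  unit-expansion : ∀ x y z →
                   x ·³ unit 0F +³ (y ·³ unit 1F +³ (z ·³ unit 2F +³ 0³)) ≡ (x , y , z)
  unit-expansion x y z = ≡³
    (solve 3 (λ x y z → P.coordinate 0F (expansion x y z) := x) refl x y z)
    (solve 3 (λ x y z → P.coordinate 1F (expansion x y z) := y) refl x y z)
    (solve 3 (λ x y z → P.coordinate 2F (expansion x y z) := z) refl x y z)
    where
    expansion : ∀ {n} → Polynomial n → Polynomial n → Polynomial n → P.K³
    expansion x y z = x P.·³ P.unit 0F P.+³ (y P.·³ P.unit 1F P.+³ (z P.·³ P.unit 2F P.+³ P.0³))

  private
    detᴾ : ∀ {n} (a b c d e f g h i : Polynomial n) → Polynomial n
    detᴾ a b c d e f g h i = P.det (a , b , c) (d , e , f) (g , h , i)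

    adjugateᴾ : ∀ {n} (a b c d e f g h i : Polynomial n) → Vec (Polynomial n) 3 → P.K³
    adjugateᴾ a b c d e f g h i = P.adjugate (a , b , c) (d , e , f) (g , h , i)

  linearForms-adjugate : ∀ m₀ m₁ m₂ u →
                         linearForms m₀ m₁ m₂ (adjugate m₀ m₁ m₂ u) ≡ det m₀ m₁ m₂ ·ᵛ u
  linearForms-adjugate (a , b , c) (d , e , f) (g , h , i) (u ∷ v ∷ w ∷ []) =
    cong₂ _∷_
      (solve 12 (λ a b c d e f g h i u v w →
         (a , b , c) P.∙ adjugateᴾ a b c d e f g h i (u ∷ v ∷ w ∷ []) := detᴾ a b c d e f g h i :* u)
         refl a b c d e f g h i u v w)
    (cong₂ _∷_
      (solve 12 (λ a b c d e f g h i u v w →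
         (d , e , f) P.∙ adjugateᴾ a b c d e f g h i (u ∷ v ∷ w ∷ []) := detᴾ a b c d e f g h i :* v)
         refl a b c d e f g h i u v w)
    (cong (_∷ [])
      (solve 12 (λ a b c d e f g h i u v w →
         (g , h , i) P.∙ adjugateᴾ a b c d e f g h i (u ∷ v ∷ w ∷ []) := detᴾ a b c d e f g h i :* w)
         refl a b c d e f g h i u v w)))

  adjugate-linearForms : ∀ m₀ m₁ m₂ X →
                         adjugate m₀ m₁ m₂ (linearForms m₀ m₁ m₂ X) ≡ det m₀ m₁ m₂ ·³ X
  adjugate-linearForms (a , b , c) (d , e , f) (g , h , i) (x , y , z) = ≡³
    (solve 12 (λ a b c d e f g h i x y z →
       P.coordinate 0F (adjugateᴾ a b c d e f g h i (forms a b c d e f g h i x y z))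
         := detᴾ a b c d e f g h i :* x) refl a b c d e f g h i x y z)
    (solve 12 (λ a b c d e f g h i x y z →
       P.coordinate 1F (adjugateᴾ a b c d e f g h i (forms a b c d e f g h i x y z))
         := detᴾ a b c d e f g h i :* y) refl a b c d e f g h i x y z)
    (solve 12 (λ a b c d e f g h i x y z →
       P.coordinate 2F (adjugateᴾ a b c d e f g h i (forms a b c d e f g h i x y z))
         := detᴾ a b c d e f g h i :* z) refl a b c d e f g h i x y z)
    where
    forms : ∀ {n} (a b c d e f g h i x y z : Polynomial n) → Vec (Polynomial n) 3
    forms a b c d e f g h i x y z = P.linearForms (a , b , c) (d , e , f) (g , h , i) (x , y , z)

  evaluate-+³ : ∀ {n} (M : Fin n → K³) X Y → evaluate M (X +³ Y) ≡ evaluate M X +ᵛ evaluate M Y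
  evaluate-+³ M X Y =
    trans (tabulate-cong (λ j → ∙-+³ (M j) X Y))
          (sym (zipWith-tabulate _⊕_ (λ j → M j ∙ X) (λ j → M j ∙ Y)))

  evaluate-·³ : ∀ {n} (M : Fin n → K³) s X → evaluate M (s ·³ X) ≡ s ·ᵛ evaluate M X
  evaluate-·³ M s X =
    trans (tabulate-cong (λ j → ∙-·³ (M j) s X)) (tabulate-∘ (s ⊗_) (λ j → M j ∙ X))

  module Cramer {m₀ m₁ m₂ : K³} (det≢𝟘 : det m₀ m₁ m₂ ≢ 𝟘) where

    linearForms-surjective : ∀ u → ∃ λ X → linearForms m₀ m₁ m₂ X ≡ u
    linearForms-surjective u with inverse (det m₀ m₁ m₂) det≢𝟘
    ... | d⁻¹ , dd⁻¹≡1 = d⁻¹ ·³ adjugate m₀ m₁ m₂ u , (begin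
      linearForms m₀ m₁ m₂ (d⁻¹ ·³ adjugate m₀ m₁ m₂ u)
        ≡⟨ evaluate-·³ (lookup (m₀ ∷ m₁ ∷ m₂ ∷ [])) d⁻¹ _ ⟩
      d⁻¹ ·ᵛ linearForms m₀ m₁ m₂ (adjugate m₀ m₁ m₂ u)
        ≡⟨ cong (d⁻¹ ·ᵛ_) (linearForms-adjugate m₀ m₁ m₂ u) ⟩
      d⁻¹ ·ᵛ (det m₀ m₁ m₂ ·ᵛ u)
        ≡⟨ inverse-·ᵛ-cancel u dd⁻¹≡1 ⟩
      u ∎)

    linearForms-injective : Injective _≡_ _≡_ (linearForms m₀ m₁ m₂)
    linearForms-injective {X} {Y} X↦≡Y↦ = ·³-cancelˡ det≢𝟘 (begin
      det m₀ m₁ m₂ ·³ X                           ≡⟨ adjugate-linearForms m₀ m₁ m₂ X ⟨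
      adjugate m₀ m₁ m₂ (linearForms m₀ m₁ m₂ X)  ≡⟨ cong (adjugate m₀ m₁ m₂) X↦≡Y↦ ⟩
      adjugate m₀ m₁ m₂ (linearForms m₀ m₁ m₂ Y)  ≡⟨ adjugate-linearForms m₀ m₁ m₂ Y ⟩
      det m₀ m₁ m₂ ·³ Y                           ∎)

    linearForms-∃! : ∀ {I : Set} (e : I ↔ K³) u →
                     ∃! _≡_ (λ i → linearForms m₀ m₁ m₂ (Inverse.to e i) ≡ u)
    linearForms-∃! e =
      ∃!-preimage e (linearForms m₀ m₁ m₂) linearForms-injective linearForms-surjective

  module _ {n} {I : Set} (e : I ↔ K³) (f : K³ → Vec Carrier n)
           (f-+³ : ∀ X Y → f (X +³ Y) ≡ f X +ᵛ f Y)
           (f-·³ : ∀ s X → f (s ·³ X) ≡ s ·ᵛ f X)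
           (f-injective : Injective _≡_ _≡_ f) where
    open Inverse e using (to; from; strictlyInverseˡ)

    private
      f∘to∘from : ∀ X → f (to (from X)) ≡ f X
      f∘to∘from X = cong f (strictlyInverseˡ X)

      f-0³ : f 0³ ≡ 0ᵛ
      f-0³ = begin
        f 0³          ≡⟨ cong f (𝟘·³ 0³) ⟨
        f (𝟘 ·³ 0³)   ≡⟨ f-·³ 𝟘 0³ ⟩
        𝟘 ·ᵛ f 0³     ≡⟨ 𝟘·ᵛ (f 0³) ⟩
        0ᵛ            ∎

      lincomb-unit : ∀ a → lincomb a (f ∘ unit) ≡ f (coordinates a)
      lincomb-unit a = begin
        (a 0F ·ᵛ f (unit 0F)) +ᵛ ((a 1F ·ᵛ f (unit 1F)) +ᵛ ((a 2F ·ᵛ f (unit 2F)) +ᵛ 0ᵛ))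
          ≡⟨ cong₂ _+ᵛ_ (f-·³ _ _) (cong₂ _+ᵛ_ (f-·³ _ _) (cong₂ _+ᵛ_ (f-·³ _ _) f-0³)) ⟨
        f (a 0F ·³ unit 0F) +ᵛ (f (a 1F ·³ unit 1F) +ᵛ (f (a 2F ·³ unit 2F) +ᵛ f 0³))
          ≡⟨ cong (_ +ᵛ_) (cong (_ +ᵛ_) (f-+³ _ _)) ⟨
        f (a 0F ·³ unit 0F) +ᵛ (f (a 1F ·³ unit 1F) +ᵛ f (a 2F ·³ unit 2F +³ 0³))
          ≡⟨ cong (_ +ᵛ_) (f-+³ _ _) ⟨
        f (a 0F ·³ unit 0F) +ᵛ f (a 1F ·³ unit 1F +³ (a 2F ·³ unit 2F +³ 0³))
          ≡⟨ f-+³ _ _ ⟨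
        f (a 0F ·³ unit 0F +³ (a 1F ·³ unit 1F +³ (a 2F ·³ unit 2F +³ 0³)))
          ≡⟨ cong f (unit-expansion (a 0F) (a 1F) (a 2F)) ⟩
        f (coordinates a) ∎

      images-of-units-independent : LinIndep (f ∘ unit)
      images-of-units-independent a lincomb≡0 =
        λ { 0F → cong (coordinate 0F) a≡0
          ; 1F → cong (coordinate 1F) a≡0
          ; 2F → cong (coordinate 2F) a≡0 }
        where
        a≡0 : coordinates a ≡ 0³
        a≡0 = f-injective (trans (sym (lincomb-unit a)) (trans lincomb≡0 (sym f-0³)))

    image-isSubspaceOfDim3 : IsSubspaceOfDim 3 (λ w → ∃ λ i → f (to i) ≡ w)
    image-isSubspaceOfDim3 =
      ( (from 0³ , trans (f∘to∘from 0³) f-0³)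
      , (λ { _ _ (i , refl) (j , refl) → from (to i +³ to j) , trans (f∘to∘from _) (f-+³ _ _) })
      , (λ { s _ (i , refl) → from (s ·³ to i) , trans (f∘to∘from _) (f-·³ s _) }) )
      , f ∘ unit
      , (λ k → from (unit k) , f∘to∘from (unit k))
      , images-of-units-independent
      , (λ { _ (i , refl) → (λ k → coordinate k (to i)) , lincomb-unit (λ k → coordinate k (to i)) })

  det-conic-conic-conic : ∀ s t u →
                          det (conic s) (conic t) (conic u) ≡ (s ⊕ t) ⊗ ((t ⊕ u) ⊗ (s ⊕ u))
  det-conic-conic-conic = solve 3 (λ s t u →
    P.det (P.conic s) (P.conic t) (P.conic u) := (s :+ t) :* ((t :+ u) :* (s :+ u))) refl

  det-conic-conic-infinity : ∀ s t → det (conic s) (conic t) infinity ≡ s ⊕ t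
  det-conic-conic-infinity = solve 2 (λ s t → P.det (P.conic s) (P.conic t) P.infinity := s :+ t) refl

  det-conic-infinity-conic : ∀ s t → det (conic s) infinity (conic t) ≡ s ⊕ t
  det-conic-infinity-conic = solve 2 (λ s t → P.det (P.conic s) P.infinity (P.conic t) := s :+ t) refl

  det-infinity-conic-conic : ∀ s t → det infinity (conic s) (conic t) ≡ s ⊕ t
  det-infinity-conic-conic = solve 2 (λ s t → P.det P.infinity (P.conic s) (P.conic t) := s :+ t) refl

  det-conic-conic-nucleus : ∀ s t → det (conic s) (conic t) nucleus ≡ (s ⊕ t) ⊗ (s ⊕ t)
  det-conic-conic-nucleus = solve 2 (λ s t →
    P.det (P.conic s) (P.conic t) P.nucleus := (s :+ t) :* (s :+ t)) refl

  det-conic-infinity-nucleus : ∀ s → det (conic s) infinity nucleus ≡ 𝟙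
  det-conic-infinity-nucleus = solve 1 (λ s → P.det (P.conic s) P.infinity P.nucleus := con true) refl

  det-infinity-conic-nucleus : ∀ s → det infinity (conic s) nucleus ≡ 𝟙
  det-infinity-conic-nucleus = solve 1 (λ s → P.det P.infinity (P.conic s) P.nucleus := con true) refl

  ovalPoint : Carrier ⊎ ⊤ → K³
  ovalPoint (inj₁ t) = conic t
  ovalPoint (inj₂ _) = infinity

  private
    ⊕-≢𝟘 : ∀ {s t} → inj₁ s ≢ inj₁ {B = ⊤} t → s ⊕ t ≢ 𝟘
    ⊕-≢𝟘 s≢t s+t≡0 = s≢t (cong inj₁ (⊕≡𝟘⇒≡ s+t≡0))

    𝟙≢𝟘 : 𝟙 ≢ 𝟘
    𝟙≢𝟘 = 𝟘≢𝟙 ∘ sym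

  ovalPoints-independent : ∀ {x y z} → x ≢ y → x ≢ z → y ≢ z →
                           det (ovalPoint x) (ovalPoint y) (ovalPoint z) ≢ 𝟘
  ovalPoints-independent {inj₁ s} {inj₁ t} {inj₁ u} x≢y x≢z y≢z =
    subst (_≢ 𝟘) (sym (det-conic-conic-conic s t u))
          (⊗-≢𝟘 (⊕-≢𝟘 x≢y) (⊗-≢𝟘 (⊕-≢𝟘 y≢z) (⊕-≢𝟘 x≢z)))
  ovalPoints-independent {inj₁ s} {inj₁ t} {inj₂ _} x≢y _ _ =
    subst (_≢ 𝟘) (sym (det-conic-conic-infinity s t)) (⊕-≢𝟘 x≢y)
  ovalPoints-independent {inj₁ s} {inj₂ _} {inj₁ u} _ x≢z _ =
    subst (_≢ 𝟘) (sym (det-conic-infinity-conic s u)) (⊕-≢𝟘 x≢z)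
  ovalPoints-independent {inj₂ _} {inj₁ t} {inj₁ u} _ _ y≢z =
    subst (_≢ 𝟘) (sym (det-infinity-conic-conic t u)) (⊕-≢𝟘 y≢z)
  ovalPoints-independent {inj₁ _} {inj₂ _} {inj₂ _} _ _ y≢z = contradiction refl y≢z
  ovalPoints-independent {inj₂ _} {inj₁ _} {inj₂ _} _ x≢z _ = contradiction refl x≢z
  ovalPoints-independent {inj₂ _} {inj₂ _} {_}      x≢y _ _ = contradiction refl x≢y

  ovalPoints-nucleus-independent : ∀ {x y} → x ≢ y → det (ovalPoint x) (ovalPoint y) nucleus ≢ 𝟘
  ovalPoints-nucleus-independent {inj₁ s} {inj₁ t} x≢y =
    subst (_≢ 𝟘) (sym (det-conic-conic-nucleus s t)) (⊗-≢𝟘 (⊕-≢𝟘 x≢y) (⊕-≢𝟘 x≢y))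
  ovalPoints-nucleus-independent {inj₁ s} {inj₂ _} _ =
    subst (_≢ 𝟘) (sym (det-conic-infinity-nucleus s)) 𝟙≢𝟘
  ovalPoints-nucleus-independent {inj₂ _} {inj₁ t} _ =
    subst (_≢ 𝟘) (sym (det-infinity-conic-nucleus t)) 𝟙≢𝟘
  ovalPoints-nucleus-independent {inj₂ _} {inj₂ _} x≢y = contradiction refl x≢y

  columns : Fin (q + 1) ↔ (Carrier ⊎ ⊤)
  columns = ↔-trans Fin.+↔⊎ (size ⊎-↔ Fin.1↔⊤)

  columnPoint : Fin (q + 1) → K³
  columnPoint = ovalPoint ∘ Inverse.to columns

  distinct-labels : ∀ {k} {c : Fin k → Fin (q + 1)} → Injective _≡_ _≡_ c →
                     ∀ {i j} → i ≢ j → Inverse.to columns (c i) ≢ Inverse.to columns (c j)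
  distinct-labels c-injective i≢j = i≢j ∘ c-injective ∘ Injection.injective (↔⇒↣ columns)

  rows : Fin (q ^ 3) ↔ K³
  rows = ^3↔×³ size

  rowVector : K³ → Vec Carrier (q + 1 + 1)
  rowVector X = evaluate columnPoint X ++ evaluate (λ _ → nucleus) X

  rowVector-+³ : ∀ X Y → rowVector (X +³ Y) ≡ rowVector X +ᵛ rowVector Y
  rowVector-+³ X Y =
    trans (cong₂ _++_ (evaluate-+³ columnPoint X Y) (evaluate-+³ (λ _ → nucleus) X Y))
          (sym (zipWith-++ _⊕_ (evaluate columnPoint X) _ (evaluate columnPoint Y) _))

  rowVector-·³ : ∀ s X → rowVector (s ·³ X) ≡ s ·ᵛ rowVector X
  rowVector-·³ s X =
    trans (cong₂ _++_ (evaluate-·³ columnPoint s X) (evaluate-·³ (λ _ → nucleus) s X))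
          (sym (map-++ (s ⊗_) (evaluate columnPoint X) _))

  rowVector-injective : Injective _≡_ _≡_ rowVector
  rowVector-injective {X} {Y} X↦≡Y↦ =
    Cramer.linearForms-injective (ovalPoints-nucleus-independent labels-distinct)
      (cong₂ _∷_ (column-eq j₀) (cong₂ _∷_ (column-eq j₁) (proj₂ columns-eq)))
    where
    open Inverse columns using (to; from; strictlyInverseˡ)
    j₀ j₁ : Fin (q + 1)
    j₀ = from (inj₁ 𝟘)
    j₁ = from (inj₂ tt)
    labels-distinct : to j₀ ≢ to j₁
    labels-distinct eq
      with () ← trans (sym (strictlyInverseˡ (inj₁ 𝟘))) (trans eq (strictlyInverseˡ (inj₂ tt)))
    columns-eq : evaluate columnPoint X ≡ evaluate columnPoint Y ×
                 evaluate (λ _ → nucleus) X ≡ evaluate (λ _ → nucleus) Y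
    columns-eq = ++-injective (evaluate columnPoint X) (evaluate columnPoint Y) X↦≡Y↦
    column-eq : ∀ j → columnPoint j ∙ X ≡ columnPoint j ∙ Y
    column-eq j = trans (sym (lookup∘tabulate (λ j → columnPoint j ∙ X) j))
                 (trans (cong (λ v → lookup v j) (proj₁ columns-eq))
                        (lookup∘tabulate (λ j → columnPoint j ∙ Y) j))

  -- On row r, the entries in chosen columns compute to linearForms of the point Inverse.to rows r.
  linearAOA : LinearAOA F 2 3 (q + 1)
  linearAOA = record
    { A      = λ r j → columnPoint j ∙ Inverse.to rows r
    ; L      = λ r → nucleus ∙ Inverse.to rows r ∷ []
    ; isOA   = λ c c-injective →
        Cramer.linearForms-∃! (ovalPoints-independent (distinct-labels c-injective {0F} {1F} λ ())
                                                      (distinct-labels c-injective {0F} {2F} λ ())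
                                                      (distinct-labels c-injective {1F} {2F} λ ()))
                              rows
    ; aug    = λ c c-injective u y → ∃!-map
        (λ {r} → ++-injective (evaluate (columnPoint ∘ c) (Inverse.to rows r)) u)
        (uncurry (cong₂ _++_))
        (Cramer.linearForms-∃!
          (ovalPoints-nucleus-independent (distinct-labels c-injective {0F} {1F} λ ())) rows (u ++ y))
    ; linear = image-isSubspaceOfDim3 rows rowVector rowVector-+³ rowVector-·³ rowVector-injective
    }

theorem3p8 : (q : ℕ) → 4 ≤ q → (∃ λ m → q ≡ 2 ^ m) →
    (F : FiniteField q) → LinearAOA F 2 3 (q + 1)
theorem3p8 q 4≤q (m , q≡2^m) F =
  Characteristic2.linearAOA F (FieldProperties.characteristic-two F (2∣2^m m q≡2^m))
  where
  2∣2^m : ∀ m → q ≡ 2 ^ m → 2 ∣ q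
  2∣2^m zero    q≡1      = contradiction (subst (4 ≤_) q≡1 4≤q) λ { (s≤s ()) }
  2∣2^m (suc k) q≡2^1+k = subst (2 ∣_) (sym q≡2^1+k) (m∣m*n (2 ^ k))
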